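{- Let $\alpha=(1+\sqrt5)/2$ and $\beta=(1-\sqrt5)/2$. For every integer $n\geq1$: \begin{gather*} \sqrt{5}\sum_{k=1}^{n}{n\choose k}\left(\tfrac{2}{\sqrt5}\right)^k\bigl(1+(-1)^{n-k}\bigr)F_{2k} = \sum_{k=0}^{n}{n\choose k}\left(\tfrac{2}{\sqrt5}\right)^k\bigl(1-(-1)^{n-k}\bigr)L_{2k},\\ \sqrt{5}\sum_{k=0}^{n}{n\choose k}\left(\tfrac{2}{3\sqrt5}\right)^k\bigl(\alpha^2+(-1)^{n-k}\beta^2\bigr)F_{4k+2} = \sum_{k=0}^{n}{n\choose k}\left(\tfrac{2}{3\sqrt5}\right)^k\bigl(\alpha^2-(-1)^{n-k}\beta^2\bigr)L_{4k+2},\\ \sqrt{5}\sum_{k=1}^{n}{n\choose k}\left(\tfrac{2}{3\sqrt5}\right)^k\bigl(1+(-1)^{n-k}\bigr)F_{4k} = \sum_{k=0}^{n}{n\choose k}\left(\tfrac{2}{3\sqrt5}\right)^k\bigl(1-(-1)^{n-k}\bigr)L_{4k},\\ \sqrt{5}\sum_{k=1}^{n}{n\choose k}\left(\tfrac{14}{9\sqrt5}\right)^k\bigl(\alpha^2+(-1)^{n-k}\beta^2\bigr)F_{2k} = \left(\tfrac79\right)^n\sum_{k=0}^{n}{n\choose k}\left(\tfrac{6}{7\sqrt5}\right)^k\bigl(1-(-1)^{n-k}\bigr)L_{4k+2},\\ \sqrt{5}\sum_{k=1}^{n}{n\choose k}\left(\tfrac{14}{9\sqrt5}\right)^k\bigl(1+(-1)^{n-k}\bigr)F_{2k}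 = \left(\tfrac79\right)^n \sum_{k=0}^{n}{n\choose k}\left(\tfrac{6}{7\sqrt5}\right)^k\bigl(1-(-1)^{n-k}\bigr)L_{4k},\\ \sqrt{5}\sum_{k=0}^{n}{n\choose k}\left(\tfrac{6}{7\sqrt5}\right)^k\bigl(1+(-1)^{n-k}\bigr)F_{4k+2} = \left(\tfrac{9}{7}\right)^n \sum_{k=0}^{n} {n\choose k} \left(\tfrac{14}{9\sqrt5}\right)^k\bigl(\alpha^2-(-1)^{n-k}\beta^2\bigr)L_{2k},\\ \sqrt{5}\sum_{k=0}^{n}{n\choose k}\left(\tfrac{2}{3\sqrt5}\right)^k\bigl(1+(-1)^{n-k}\bigr)F_{4k+2} = \sum_{k=0}^{n} {n\choose k} \left(\tfrac{2}{3\sqrt5}\right)^k\bigl(\alpha^2-(-1)^{n-k}\beta^2\bigr)L_{4k},\\ \sqrt{5}\sum_{k=1}^{n}{n\choose k}\left(\tfrac{6}{7\sqrt5}\right)^k\bigl(1+(-1)^{n-k}\bigr)F_{4k} = \left(\tfrac{9}{7}\right)^n\sum_{k=0}^{n} {n\choose k} \left(\tfrac{14}{9\sqrt5}\right)^k\bigl(1-(-1)^{n-k}\bigr)L_{2k},\\ \sqrt{5}\sum_{k=1}^{n}{n\choose k}\left(\tfrac{2}{3\sqrt5}\right)^k\bigl(\alpha^2+(-1)^{n-k}\beta^2\bigr)F_{4k} = \sum_{k=0}^{n}{n\choose k} \left(\tfrac{2}{3\sqrt5}\right)^k\bigl(1-(-1)^{n-k}\bigr)L_{4k+2}. \end{g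ather*}
   Context: $F_n$ and $L_n$ are the Fibonacci and Lucas numbers: $u_n=u_{n-1}+u_{n-2}$ with $F_0=0,F_1=1$ and $L_0=2,L_1=1$. -}

module Defs where

open import Data.Nat as ℕ using (ℕ; zero; suc)
open import Data.Nat.Combinatorics using (_C_)
open import Data.Rational as ℚ using (ℚ)
open import Data.Integer using (+_)
open import Relation.Binary.PropositionalEquality using (_≡_; refl)

fib : ℕ → ℕ
fib zero = 0
fib (suc zero) = 1
fib (suc (suc n)) = fib (suc n) ℕ.+ fib n

lucas : ℕ → ℕ
lucas zero = 2
lucas (suc zero) = 1
lucas (suc (suc n)) = lucas (suc n) ℕ.+ lucas n

fromℕ : ℕ → ℚ
fromℕ n = + n ℚ./ 1

-- The real quadratic field ℚ(√5): a + b√5 represented as the pair (a , b).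
-- Components are normalised rationals, so _≡_ is the field's equality.
record ℚ√5 : Set where
  constructor _+_√5
  field
    re : ℚ
    im : ℚ

infixl 6 _⊕_ _⊖_
infixl 7 _⊗_
infixr 8 _^_

_⊕_ : ℚ√5 → ℚ√5 → ℚ√5
(a + b √5) ⊕ (c + d √5) = (a ℚ.+ c) + (b ℚ.+ d) √5

neg : ℚ√5 → ℚ√5
neg (a + b √5) = (ℚ.- a) + (ℚ.- b) √5

_⊖_ : ℚ√5 → ℚ√5 → ℚ√5
x ⊖ y = x ⊕ neg y

_⊗_ : ℚ√5 → ℚ√5 → ℚ√5
(a + b √5) ⊗ (c + d √5) =
  (a ℚ.* c ℚ.+ fromℕ 5 ℚ.* (b ℚ.* d)) + (a ℚ.* d ℚ.+ b ℚ.* c) √5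

ι : ℚ → ℚ√5
ι q = q + ℚ.0ℚ √5

ιℕ : ℕ → ℚ√5
ιℕ n = ι (fromℕ n)

𝟘 𝟙 : ℚ√5
𝟘 = ιℕ 0
𝟙 = ιℕ 1

_^_ : ℚ√5 → ℕ → ℚ√5
x ^ zero = 𝟙
x ^ suc n = x ⊗ (x ^ n)

√5 : ℚ√5
√5 = ℚ.0ℚ + ℚ.1ℚ √5

inv√5 : ℚ√5
inv√5 = ℚ.0ℚ + (+ 1 ℚ./ 5) √5

√5-inv : √5 ⊗ inv√5 ≡ 𝟙
√5-inv = refl

_/√5 : ℚ → ℚ√5
q /√5 = ι q ⊗ inv√5

α β : ℚ√5
α = (+ 1 ℚ./ 2) + (+ 1 ℚ./ 2) √5
β = (+ 1 ℚ./ 2) + (ℚ.- (+ 1 ℚ./ 2)) √5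

-- Finite sums: Σ_{k=0}^{n} f k and Σ_{k=1}^{n} f k
Σ₀ : ℕ → (ℕ → ℚ√5) → ℚ√5
Σ₀ zero f = f 0
Σ₀ (suc n) f = Σ₀ n f ⊕ f (suc n)

Σ₁ : ℕ → (ℕ → ℚ√5) → ℚ√5
Σ₁ zero f = 𝟘
Σ₁ (suc n) f = Σ₀ n (λ j → f (suc j))

binom : ℕ → ℕ → ℚ√5
binom n k = ιℕ (n C k)

sgn : ℕ → ℚ√5
sgn m = neg 𝟙 ^ m

F L : ℕ → ℚ√5
F n = ιℕ (fib n)
L n = ιℕ (lucas n)

{-# OPTIONS --safe #-}
-- By Binet's formulas √5 F_m = α^m − β^m and L_m = α^m + β^m, so each side is a sum
-- Σ_k C(n,k) x^k (P + (−1)^(n−k) Q) (U A^k + V B^k), which the binomial theorem evaluates to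
-- U (P (xA+1)^n + Q (xA−1)^n) + V (P (xB+1)^n + Q (xB−1)^n).  Passing from the Fibonacci side to
-- the Lucas side exchanges (P,Q) with (U,V), which leaves this expression unchanged once the 2×2
-- array of bases is transposed.  So each identity reduces to relations between the bases: e.g.
-- x(α²−β²) = 2 for x = 2/√5 gives xα²−1 = xβ²+1, and when the two sides use different x, the
-- bases of one side are a fixed multiple s of the transposed bases of the other, giving s^n.
module Submission where

open import Defs
open import Algebra.Bundles using (CommutativeRing)
open import Algebra.Structures using (IsCommutativeRing)
import Algebra.Properties.CommutativeSemiring.Binomial as Binomial
import Algebra.Properties.CommutativeSemiring.Exp as CommutativeExp
import Algebra.Properties.Ring as RingProperties
import Algebra.Properties.Semiring.Exp as Exp
import Algebra.Properties.Semiring.Mult as Mult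
import Algebra.Properties.Semiring.Sum as Sum
import Algebra.Solver.Ring.AlmostCommutativeRing as ACR
import Algebra.Solver.Ring.Simple as Solver
open import Data.Fin using (toℕ)
open import Data.Integer as ℤ using (+_)
import Data.Integer.Properties as ℤP
open import Data.Nat using (ℕ; zero; suc; _≤_; _∸_; _*_; _+_)
open import Data.Nat.Combinatorics using (_C_)
import Data.Nat.Properties as ℕP
open import Data.Product using (_×_; _,_)
open import Data.Rational as ℚ using (_/_)
import Data.Rational.Properties as ℚP
open import Data.Rational.Solver using (module +-*-Solver)
import Data.Rational.Unnormalised as ℚᵘ
import Data.Rational.Unnormalised.Properties as ℚᵘP
open import Level using (0ℓ)
open import Relation.Binary.PropositionalEquality
open import Relation.Nullary using (Dec; yes; no)

⊕-assoc : ∀ x y z → (x ⊕ y) ⊕ z ≡ x ⊕ (y ⊕ z)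
⊕-assoc (a + b √5) (c + d √5) (e + f √5) = cong₂ _+_√5 (ℚP.+-assoc a c e) (ℚP.+-assoc b d f)

⊕-comm : ∀ x y → x ⊕ y ≡ y ⊕ x
⊕-comm (a + b √5) (c + d √5) = cong₂ _+_√5 (ℚP.+-comm a c) (ℚP.+-comm b d)

⊕-identityˡ : ∀ x → 𝟘 ⊕ x ≡ x
⊕-identityˡ (a + b √5) = cong₂ _+_√5 (ℚP.+-identityˡ a) (ℚP.+-identityˡ b)

⊕-identityʳ : ∀ x → x ⊕ 𝟘 ≡ x
⊕-identityʳ (a + b √5) = cong₂ _+_√5 (ℚP.+-identityʳ a) (ℚP.+-identityʳ b)

⊕-inverseˡ : ∀ x → neg x ⊕ x ≡ 𝟘
⊕-inverseˡ (a + b √5) = cong₂ _+_√5 (ℚP.+-inverseˡ a) (ℚP.+-inverseˡ b)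

⊕-inverseʳ : ∀ x → x ⊕ neg x ≡ 𝟘
⊕-inverseʳ (a + b √5) = cong₂ _+_√5 (ℚP.+-inverseʳ a) (ℚP.+-inverseʳ b)

module _ where
  open +-*-Solver

  ⊗-comm : ∀ x y → x ⊗ y ≡ y ⊗ x
  ⊗-comm (a + b √5) (c + d √5) = cong₂ _+_√5
    (solve 5 (λ a b c d f → a :* c :+ f :* (b :* d) := c :* a :+ f :* (d :* b)) refl a b c d (fromℕ 5))
    (solve 4 (λ a b c d → a :* d :+ b :* c := c :* b :+ d :* a) refl a b c d)

  ⊗-assoc : ∀ x y z → (x ⊗ y) ⊗ z ≡ x ⊗ (y ⊗ z)
  ⊗-assoc (a + b √5) (c + d √5) (e + g √5) = cong₂ _+_√5
    (solve 7 (λ a b c d e g f →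
         (a :* c :+ f :* (b :* d)) :* e :+ f :* ((a :* d :+ b :* c) :* g)
      := a :* (c :* e :+ f :* (d :* g)) :+ f :* (b :* (c :* g :+ d :* e))) refl a b c d e g (fromℕ 5))
    (solve 7 (λ a b c d e g f →
         (a :* c :+ f :* (b :* d)) :* g :+ (a :* d :+ b :* c) :* e
      := a :* (c :* g :+ d :* e) :+ b :* (c :* e :+ f :* (d :* g))) refl a b c d e g (fromℕ 5))

  ⊗-identityˡ : ∀ x → 𝟙 ⊗ x ≡ x
  ⊗-identityˡ (a + b √5) = cong₂ _+_√5
    (solve 3 (λ a b f → con ℚ.1ℚ :* a :+ f :* (con ℚ.0ℚ :* b) := a) refl a b (fromℕ 5))
    (solve 2 (λ a b → con ℚ.1ℚ :* b :+ con ℚ.0ℚ :* a := b) refl a b)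

  ⊗-distribˡ-⊕ : ∀ x y z → x ⊗ (y ⊕ z) ≡ x ⊗ y ⊕ x ⊗ z
  ⊗-distribˡ-⊕ (a + b √5) (c + d √5) (e + g √5) = cong₂ _+_√5
    (solve 7 (λ a b c d e g f →
         a :* (c :+ e) :+ f :* (b :* (d :+ g))
      := (a :* c :+ f :* (b :* d)) :+ (a :* e :+ f :* (b :* g))) refl a b c d e g (fromℕ 5))
    (solve 6 (λ a b c d e g →
         a :* (d :+ g) :+ b :* (c :+ e)
      := (a :* d :+ b :* c) :+ (a :* g :+ b :* e)) refl a b c d e g)

⊗-identityʳ : ∀ x → x ⊗ 𝟙 ≡ x
⊗-identityʳ x = trans (⊗-comm x 𝟙) (⊗-identityˡ x)

⊗-distribʳ-⊕ : ∀ x y z → (y ⊕ z) ⊗ x ≡ y ⊗ x ⊕ z ⊗ x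
⊗-distribʳ-⊕ x y z =
  trans (⊗-comm (y ⊕ z) x) (trans (⊗-distribˡ-⊕ x y z) (cong₂ _⊕_ (⊗-comm x y) (⊗-comm x z)))

ℚ√5-isCommutativeRing : IsCommutativeRing _≡_ _⊕_ _⊗_ neg 𝟘 𝟙
ℚ√5-isCommutativeRing = record
  { isRing = record
    { +-isAbelianGroup = record
      { isGroup = record
        { isMonoid = record
          { isSemigroup = record
            { isMagma = record { isEquivalence = isEquivalence ; ∙-cong = cong₂ _⊕_ }
            ; assoc = ⊕-assoc }
          ; identity = ⊕-identityˡ , ⊕-identityʳ }
        ; inverse = ⊕-inverseˡ , ⊕-inverseʳ
        ; ⁻¹-cong = cong neg }
      ; comm = ⊕-comm }
    ; *-cong = cong₂ _⊗_
    ; *-assoc = ⊗-assoc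
    ; *-identity = ⊗-identityˡ , ⊗-identityʳ
    ; distrib = ⊗-distribˡ-⊕ , ⊗-distribʳ-⊕ }
  ; *-comm = ⊗-comm }

ℚ√5-commutativeRing : CommutativeRing 0ℓ 0ℓ
ℚ√5-commutativeRing = record { isCommutativeRing = ℚ√5-isCommutativeRing }

open CommutativeRing ℚ√5-commutativeRing using (zeroˡ; zeroʳ; semiring; commutativeSemiring)
open RingProperties (CommutativeRing.ring ℚ√5-commutativeRing) using (-‿distribˡ-*; -‿distribʳ-*)
module StdExp = Exp semiring
module StdMult = Mult semiring
module StdSum = Sum semiring

_≟_ : (x y : ℚ√5) → Dec (x ≡ y)
(a + b √5) ≟ (c + d √5) with a ℚP.≟ c | b ℚP.≟ d
... | yes refl | yes refl = yes refl
... | no a≢c   | _        = no λ { refl → a≢c refl }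
... | _        | no b≢d   = no λ { refl → b≢d refl }

open Solver (ACR.fromCommutativeRing ℚ√5-commutativeRing) _≟_
  using (solve; _:=_; _:+_; _:-_; _:*_)

-- fromℕ normalises by a gcd, which does not compute on variables, so the sum is compared in ℚᵘ.
fromℕ-+ : ∀ m n → fromℕ (m + n) ≡ fromℕ m ℚ.+ fromℕ n
fromℕ-+ m n = ℚP.toℚᵘ-injective (begin
    ℚ.toℚᵘ (fromℕ (m + n))                        ≈⟨ ℚP.toℚᵘ-fromℚᵘ (ℚᵘ.mkℚᵘ (+ (m + n)) 0) ⟩
    ℚᵘ.mkℚᵘ (+ (m + n)) 0                         ≈⟨ ℚᵘ.*≡* (cong (ℤ._* + 1) numerators) ⟩
    ℚᵘ.mkℚᵘ (+ m) 0 ℚᵘ.+ ℚᵘ.mkℚᵘ (+ n) 0          ≈⟨ ℚᵘP.+-cong (ℚP.toℚᵘ-fromℚᵘ (ℚᵘ.mkℚᵘ (+ m) 0))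
                                                                 (ℚP.toℚᵘ-fromℚᵘ (ℚᵘ.mkℚᵘ (+ n) 0)) ⟨
    ℚ.toℚᵘ (fromℕ m) ℚᵘ.+ ℚ.toℚᵘ (fromℕ n)         ≈⟨ ℚP.toℚᵘ-homo-+ (fromℕ m) (fromℕ n) ⟨
    ℚ.toℚᵘ (fromℕ m ℚ.+ fromℕ n)                   ∎)
  where
  open ℚᵘP.≃-Reasoning
  numerators : + (m + n) ≡ + m ℤ.* + 1 ℤ.+ + n ℤ.* + 1
  numerators = trans (ℤP.pos-+ m n) (sym (cong₂ ℤ._+_ (ℤP.*-identityʳ (+ m)) (ℤP.*-identityʳ (+ n))))

ιℕ-+ : ∀ m n → ιℕ (m + n) ≡ ιℕ m ⊕ ιℕ n
ιℕ-+ m n = cong₂ _+_√5 (fromℕ-+ m n) refl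

^≡stdlib^ : ∀ x n → x StdExp.^ n ≡ x ^ n
^≡stdlib^ x zero    = refl
^≡stdlib^ x (suc n) = cong (x ⊗_) (^≡stdlib^ x n)

^-homo-⊗ : ∀ x m n → x ^ (m + n) ≡ x ^ m ⊗ x ^ n
^-homo-⊗ x m n = trans (sym (^≡stdlib^ x (m + n)))
  (trans (StdExp.^-homo-* x m n) (cong₂ _⊗_ (^≡stdlib^ x m) (^≡stdlib^ x n)))

^-assocʳ : ∀ x m n → (x ^ m) ^ n ≡ x ^ (m * n)
^-assocʳ x m n = trans (sym (trans (cong (StdExp._^ n) (^≡stdlib^ x m)) (^≡stdlib^ (x ^ m) n)))
  (trans (StdExp.^-assocʳ x m n) (^≡stdlib^ x (m * n)))

^-distribʳ-⊗ : ∀ x y n → (x ⊗ y) ^ n ≡ x ^ n ⊗ y ^ n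
^-distribʳ-⊗ x y n = trans (sym (^≡stdlib^ (x ⊗ y) n))
  (trans (CommutativeExp.^-distrib-* commutativeSemiring x y n) (cong₂ _⊗_ (^≡stdlib^ x n) (^≡stdlib^ y n)))

^-zeroˡ : ∀ n → 𝟙 ^ n ≡ 𝟙
^-zeroˡ zero    = refl
^-zeroˡ (suc n) = trans (⊗-identityˡ (𝟙 ^ n)) (^-zeroˡ n)

^-progression : ∀ x a b k → x ^ (a * k + b) ≡ x ^ b ⊗ (x ^ a) ^ k
^-progression x a b k =
  trans (^-homo-⊗ x (a * k) b) (trans (⊗-comm (x ^ (a * k)) (x ^ b)) (cong (x ^ b ⊗_) (sym (^-assocʳ x a k))))

^-fibonacci : ∀ x → x ⊗ x ≡ x ⊕ 𝟙 → ∀ m → x ^ suc (suc m) ≡ x ^ suc m ⊕ x ^ m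
^-fibonacci x x²≡x+1 m = begin
  x ⊗ (x ⊗ x ^ m)      ≡⟨ ⊗-assoc x x (x ^ m) ⟨
  (x ⊗ x) ⊗ x ^ m      ≡⟨ cong (_⊗ x ^ m) x²≡x+1 ⟩
  (x ⊕ 𝟙) ⊗ x ^ m      ≡⟨ ⊗-distribʳ-⊕ (x ^ m) x 𝟙 ⟩
  x ⊗ x ^ m ⊕ 𝟙 ⊗ x ^ m ≡⟨ cong (x ⊗ x ^ m ⊕_) (⊗-identityˡ (x ^ m)) ⟩
  x ^ suc m ⊕ x ^ m    ∎
  where open ≡-Reasoning

binetF : ∀ m → √5 ⊗ F m ≡ α ^ m ⊖ β ^ m
binetF zero          = refl
binetF (suc zero)    = refl
binetF (suc (suc m)) = begin
  √5 ⊗ ιℕ (fib (suc m) + fib m)                  ≡⟨ cong (√5 ⊗_) (ιℕ-+ (fib (suc m)) (fib m)) ⟩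
  √5 ⊗ (F (suc m) ⊕ F m)                          ≡⟨ ⊗-distribˡ-⊕ √5 (F (suc m)) (F m) ⟩
  √5 ⊗ F (suc m) ⊕ √5 ⊗ F m                       ≡⟨ cong₂ _⊕_ (binetF (suc m)) (binetF m) ⟩
  (α ^ suc m ⊖ β ^ suc m) ⊕ (α ^ m ⊖ β ^ m)      ≡⟨ solve 4 (λ a b c d → (a :- b) :+ (c :- d) := (a :+ c) :- (b :+ d))
                                                       refl (α ^ suc m) (β ^ suc m) (α ^ m) (β ^ m) ⟩
  (α ^ suc m ⊕ α ^ m) ⊖ (β ^ suc m ⊕ β ^ m)      ≡⟨ cong₂ _⊖_ (^-fibonacci α refl m) (^-fibonacci β refl m) ⟨
  α ^ suc (suc m) ⊖ β ^ suc (suc m)               ∎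
  where open ≡-Reasoning

binetL : ∀ m → L m ≡ α ^ m ⊕ β ^ m
binetL zero          = refl
binetL (suc zero)    = refl
binetL (suc (suc m)) = begin
  ιℕ (lucas (suc m) + lucas m)                    ≡⟨ ιℕ-+ (lucas (suc m)) (lucas m) ⟩
  L (suc m) ⊕ L m                                 ≡⟨ cong₂ _⊕_ (binetL (suc m)) (binetL m) ⟩
  (α ^ suc m ⊕ β ^ suc m) ⊕ (α ^ m ⊕ β ^ m)      ≡⟨ solve 4 (λ a b c d → (a :+ b) :+ (c :+ d) := (a :+ c) :+ (b :+ d))
                                                       refl (α ^ suc m) (β ^ suc m) (α ^ m) (β ^ m) ⟩
  (α ^ suc m ⊕ α ^ m) ⊕ (β ^ suc m ⊕ β ^ m)      ≡⟨ cong₂ _⊕_ (^-fibonacci α refl m) (^-fibonacci β refl m) ⟨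
  α ^ suc (suc m) ⊕ β ^ suc (suc m)               ∎
  where open ≡-Reasoning

binetF-progression : ∀ a b k → √5 ⊗ F (a * k + b) ≡ α ^ b ⊗ (α ^ a) ^ k ⊖ β ^ b ⊗ (β ^ a) ^ k
binetF-progression a b k = trans (binetF (a * k + b)) (cong₂ _⊖_ (^-progression α a b k) (^-progression β a b k))

binetL-progression : ∀ a b k → L (a * k + b) ≡ α ^ b ⊗ (α ^ a) ^ k ⊕ β ^ b ⊗ (β ^ a) ^ k
binetL-progression a b k = trans (binetL (a * k + b)) (cong₂ _⊕_ (^-progression α a b k) (^-progression β a b k))

Σ₀-cong : ∀ n {f g : ℕ → ℚ√5} → (∀ k → f k ≡ g k) → Σ₀ n f ≡ Σ₀ n g
Σ₀-cong zero    f≗g = f≗g 0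
Σ₀-cong (suc n) f≗g = cong₂ _⊕_ (Σ₀-cong n f≗g) (f≗g (suc n))

⊗-distribˡ-Σ₀ : ∀ n c (f : ℕ → ℚ√5) → c ⊗ Σ₀ n f ≡ Σ₀ n (λ k → c ⊗ f k)
⊗-distribˡ-Σ₀ zero    c f = refl
⊗-distribˡ-Σ₀ (suc n) c f =
  trans (⊗-distribˡ-⊕ c (Σ₀ n f) (f (suc n))) (cong (_⊕ c ⊗ f (suc n)) (⊗-distribˡ-Σ₀ n c f))

Σ₀-linear : ∀ n a b (f g : ℕ → ℚ√5) → Σ₀ n (λ k → a ⊗ f k ⊕ b ⊗ g k) ≡ a ⊗ Σ₀ n f ⊕ b ⊗ Σ₀ n g
Σ₀-linear zero    a b f g = refl
Σ₀-linear (suc n) a b f g = trans (cong (_⊕ (a ⊗ f (suc n) ⊕ b ⊗ g (suc n))) (Σ₀-linear n a b f g))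
  (solve 6 (λ a b s t u v → (a :* s :+ b :* t) :+ (a :* u :+ b :* v) := a :* (s :+ u) :+ b :* (t :+ v)) refl
    a b (Σ₀ n f) (Σ₀ n g) (f (suc n)) (g (suc n)))

Σ₀-head : ∀ n (f : ℕ → ℚ√5) → Σ₀ (suc n) f ≡ f 0 ⊕ Σ₀ n (λ k → f (suc k))
Σ₀-head zero    f = refl
Σ₀-head (suc n) f = trans (cong (_⊕ f (suc (suc n))) (Σ₀-head n f)) (⊕-assoc (f 0) _ _)

Σ₁≡Σ₀ : ∀ n (f : ℕ → ℚ√5) → f 0 ≡ 𝟘 → Σ₁ n f ≡ Σ₀ n f
Σ₁≡Σ₀ zero    f f0≡0 = sym f0≡0
Σ₁≡Σ₀ (suc n) f f0≡0 = sym (begin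
  Σ₀ (suc n) f                         ≡⟨ Σ₀-head n f ⟩
  f 0 ⊕ Σ₀ n (λ k → f (suc k))         ≡⟨ cong (_⊕ Σ₀ n (λ k → f (suc k))) f0≡0 ⟩
  𝟘 ⊕ Σ₀ n (λ k → f (suc k))           ≡⟨ ⊕-identityˡ _ ⟩
  Σ₀ n (λ k → f (suc k))               ∎)
  where open ≡-Reasoning

Σ₀≡sum : ∀ n (f : ℕ → ℚ√5) → Σ₀ n f ≡ StdSum.sum {suc n} (λ i → f (toℕ i))
Σ₀≡sum zero    f = sym (⊕-identityʳ (f 0))
Σ₀≡sum (suc n) f = trans (Σ₀-head n f) (cong (f 0 ⊕_) (Σ₀≡sum n (λ k → f (suc k))))

×≡ιℕ⊗ : ∀ m z → m StdMult.× z ≡ ιℕ m ⊗ z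
×≡ιℕ⊗ zero    z = sym (zeroˡ z)
×≡ιℕ⊗ (suc m) z = begin
  z ⊕ m StdMult.× z    ≡⟨ cong₂ _⊕_ (sym (⊗-identityˡ z)) (×≡ιℕ⊗ m z) ⟩
  𝟙 ⊗ z ⊕ ιℕ m ⊗ z     ≡⟨ ⊗-distribʳ-⊕ z 𝟙 (ιℕ m) ⟨
  (𝟙 ⊕ ιℕ m) ⊗ z       ≡⟨ cong (_⊗ z) (ιℕ-+ 1 m) ⟨
  ιℕ (suc m) ⊗ z       ∎
  where open ≡-Reasoning

Σ₀-binomial : ∀ n a b → Σ₀ n (λ k → binom n k ⊗ (a ^ k ⊗ b ^ (n ∸ k))) ≡ (a ⊕ b) ^ n
Σ₀-binomial n a b = begin
  Σ₀ n (λ k → binom n k ⊗ (a ^ k ⊗ b ^ (n ∸ k)))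
    ≡⟨ Σ₀≡sum n _ ⟩
  StdSum.sum {suc n} (λ i → binom n (toℕ i) ⊗ (a ^ toℕ i ⊗ b ^ (n ∸ toℕ i)))
    ≡⟨ StdSum.sum-cong-≗ {suc n} term ⟨
  Binomial.binomialExpansion commutativeSemiring a b n
    ≡⟨ Binomial.theorem commutativeSemiring n a b ⟨
  (a ⊕ b) StdExp.^ n
    ≡⟨ ^≡stdlib^ (a ⊕ b) n ⟩
  (a ⊕ b) ^ n ∎
  where
  open ≡-Reasoning
  term : ∀ i → Binomial.binomialTerm commutativeSemiring a b n i
             ≡ binom n (toℕ i) ⊗ (a ^ toℕ i ⊗ b ^ (n ∸ toℕ i))
  term i = trans (×≡ιℕ⊗ (n C toℕ i) _)
    (cong (binom n (toℕ i) ⊗_) (cong₂ _⊗_ (^≡stdlib^ a (toℕ i)) (^≡stdlib^ b (n ∸ toℕ i))))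

binomialSum : ℕ → ℚ√5 → (ℕ → ℚ√5) → (ℕ → ℚ√5) → ℚ√5
binomialSum n x c g = Σ₀ n (λ k → binom n k ⊗ x ^ k ⊗ c (n ∸ k) ⊗ g k)

Σ₁-binomialSum : ∀ n x c g → g 0 ≡ 𝟘 →
  Σ₁ n (λ k → binom n k ⊗ x ^ k ⊗ c (n ∸ k) ⊗ g k) ≡ binomialSum n x c g
Σ₁-binomialSum n x c g g0≡0 =
  Σ₁≡Σ₀ n _ (trans (cong (binom n 0 ⊗ x ^ 0 ⊗ c n ⊗_) g0≡0) (zeroʳ (binom n 0 ⊗ x ^ 0 ⊗ c n)))

binomialSum-geometric : ∀ n x P Q A →
  binomialSum n x (λ m → P ⊕ sgn m ⊗ Q) (A ^_) ≡ P ⊗ (x ⊗ A ⊕ 𝟙) ^ n ⊕ Q ⊗ (x ⊗ A ⊖ 𝟙) ^ n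
binomialSum-geometric n x P Q A = begin
  binomialSum n x (λ m → P ⊕ sgn m ⊗ Q) (A ^_)     ≡⟨ Σ₀-cong n split ⟩
  Σ₀ n (λ k → P ⊗ term 𝟙 k ⊕ Q ⊗ term (neg 𝟙) k)  ≡⟨ Σ₀-linear n P Q (term 𝟙) (term (neg 𝟙)) ⟩
  P ⊗ Σ₀ n (term 𝟙) ⊕ Q ⊗ Σ₀ n (term (neg 𝟙))      ≡⟨ cong₂ _⊕_ (cong (P ⊗_) (Σ₀-binomial n (x ⊗ A) 𝟙))
                                                                 (cong (Q ⊗_) (Σ₀-binomial n (x ⊗ A) (neg 𝟙))) ⟩
  P ⊗ (x ⊗ A ⊕ 𝟙) ^ n ⊕ Q ⊗ (x ⊗ A ⊖ 𝟙) ^ n        ∎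
  where
  open ≡-Reasoning
  term : ℚ√5 → ℕ → ℚ√5
  term b k = binom n k ⊗ ((x ⊗ A) ^ k ⊗ b ^ (n ∸ k))
  split : ∀ k → binom n k ⊗ x ^ k ⊗ (P ⊕ sgn (n ∸ k) ⊗ Q) ⊗ A ^ k ≡ P ⊗ term 𝟙 k ⊕ Q ⊗ term (neg 𝟙) k
  split k = begin
    W ⊗ x ^ k ⊗ (P ⊕ s ⊗ Q) ⊗ A ^ k
      ≡⟨ solve 6 (λ W X Y P Q s → W :* X :* (P :+ s :* Q) :* Y := P :* (W :* (X :* Y)) :+ Q :* (W :* (X :* Y :* s)))
           refl W (x ^ k) (A ^ k) P Q s ⟩
    P ⊗ (W ⊗ (x ^ k ⊗ A ^ k)) ⊕ Q ⊗ (W ⊗ (x ^ k ⊗ A ^ k ⊗ s))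
      ≡⟨ cong₂ (λ u v → P ⊗ (W ⊗ u) ⊕ Q ⊗ (W ⊗ v))
           (trans (cong₂ _⊗_ (^-distribʳ-⊗ x A k) (^-zeroˡ (n ∸ k))) (⊗-identityʳ (x ^ k ⊗ A ^ k)))
           (cong (_⊗ s) (^-distribʳ-⊗ x A k)) ⟨
    P ⊗ term 𝟙 k ⊕ Q ⊗ term (neg 𝟙) k
      ∎
    where
    W s : ℚ√5
    W = binom n k
    s = sgn (n ∸ k)

bilinearPowerSum : (U V P Q a b c d : ℚ√5) → ℕ → ℚ√5
bilinearPowerSum U V P Q a b c d n = U ⊗ (P ⊗ a ^ n ⊕ Q ⊗ b ^ n) ⊕ V ⊗ (P ⊗ c ^ n ⊕ Q ⊗ d ^ n)

bilinearPowerSum-transpose : ∀ U V P Q a b c d n →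
  bilinearPowerSum U V P Q a b c d n ≡ bilinearPowerSum P Q U V a c b d n
bilinearPowerSum-transpose U V P Q a b c d n =
  solve 8 (λ U V P Q a b c d → U :* (P :* a :+ Q :* b) :+ V :* (P :* c :+ Q :* d)
                            := P :* (U :* a :+ V :* c) :+ Q :* (U :* b :+ V :* d))
    refl U V P Q (a ^ n) (b ^ n) (c ^ n) (d ^ n)

bilinearPowerSum-scale : ∀ s U V P Q a b c d n →
  s ^ n ⊗ bilinearPowerSum U V P Q a b c d n ≡ bilinearPowerSum U V P Q (s ⊗ a) (s ⊗ b) (s ⊗ c) (s ⊗ d) n
bilinearPowerSum-scale s U V P Q a b c d n = begin
  s ^ n ⊗ bilinearPowerSum U V P Q a b c d n
    ≡⟨ solve 9 (λ S U V P Q a b c d → S :* (U :* (P :* a :+ Q :* b) :+ V :* (P :* c :+ Q :* d))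
                                   := U :* (P :* (S :* a) :+ Q :* (S :* b)) :+ V :* (P :* (S :* c) :+ Q :* (S :* d)))
         refl (s ^ n) U V P Q (a ^ n) (b ^ n) (c ^ n) (d ^ n) ⟩
  U ⊗ (P ⊗ (s ^ n ⊗ a ^ n) ⊕ Q ⊗ (s ^ n ⊗ b ^ n)) ⊕ V ⊗ (P ⊗ (s ^ n ⊗ c ^ n) ⊕ Q ⊗ (s ^ n ⊗ d ^ n))
    ≡⟨ cong₂ (λ y z → U ⊗ y ⊕ V ⊗ z) (cong₂ (λ y z → P ⊗ y ⊕ Q ⊗ z) (scaled a) (scaled b))
                                      (cong₂ (λ y z → P ⊗ y ⊕ Q ⊗ z) (scaled c) (scaled d)) ⟨
  bilinearPowerSum U V P Q (s ⊗ a) (s ⊗ b) (s ⊗ c) (s ⊗ d) n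
    ∎
  where
  open ≡-Reasoning
  scaled : ∀ y → (s ⊗ y) ^ n ≡ s ^ n ⊗ y ^ n
  scaled y = ^-distribʳ-⊗ s y n

binomialSum-closedForm : ∀ n x P Q U V A B {c g : ℕ → ℚ√5} →
  (∀ m → c m ≡ P ⊕ sgn m ⊗ Q) → (∀ k → g k ≡ U ⊗ A ^ k ⊕ V ⊗ B ^ k) →
  binomialSum n x c g ≡ bilinearPowerSum U V P Q (x ⊗ A ⊕ 𝟙) (x ⊗ A ⊖ 𝟙) (x ⊗ B ⊕ 𝟙) (x ⊗ B ⊖ 𝟙) n
binomialSum-closedForm n x P Q U V A B {c} {g} c≗ g≗ = begin
  binomialSum n x c g                            ≡⟨ Σ₀-cong n split ⟩
  Σ₀ n (λ k → U ⊗ geometric A k ⊕ V ⊗ geometric B k) ≡⟨ Σ₀-linear n U V (geometric A) (geometric B) ⟩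
  U ⊗ Σ₀ n (geometric A) ⊕ V ⊗ Σ₀ n (geometric B) ≡⟨ cong₂ _⊕_ (cong (U ⊗_) (binomialSum-geometric n x P Q A))
                                                               (cong (V ⊗_) (binomialSum-geometric n x P Q B)) ⟩
  bilinearPowerSum U V P Q (x ⊗ A ⊕ 𝟙) (x ⊗ A ⊖ 𝟙) (x ⊗ B ⊕ 𝟙) (x ⊗ B ⊖ 𝟙) n ∎
  where
  open ≡-Reasoning
  geometric : ℚ√5 → ℕ → ℚ√5
  geometric y k = binom n k ⊗ x ^ k ⊗ (P ⊕ sgn (n ∸ k) ⊗ Q) ⊗ y ^ k
  split : ∀ k → binom n k ⊗ x ^ k ⊗ c (n ∸ k) ⊗ g k ≡ U ⊗ geometric A k ⊕ V ⊗ geometric B k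
  split k = trans (cong₂ (λ u v → binom n k ⊗ x ^ k ⊗ u ⊗ v) (c≗ (n ∸ k)) (g≗ k))
    (solve 6 (λ W U a V b c → W :* c :* (U :* a :+ V :* b) := U :* (W :* c :* a) :+ V :* (W :* c :* b))
      refl (binom n k ⊗ x ^ k) U (A ^ k) V (B ^ k) (P ⊕ sgn (n ∸ k) ⊗ Q))

⊗-distribˡ-binomialSum : ∀ n r x c g → r ⊗ binomialSum n x c g ≡ binomialSum n x c (λ k → r ⊗ g k)
⊗-distribˡ-binomialSum n r x c g = trans (⊗-distribˡ-Σ₀ n r _) (Σ₀-cong n λ k →
  solve 3 (λ r w v → r :* (w :* v) := w :* (r :* v)) refl r (binom n k ⊗ x ^ k ⊗ c (n ∸ k)) (g k))

binomialSum-duality : ∀ n x x′ s P Q U V A B A′ B′ {c c′ g h : ℕ → ℚ√5} →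
  (∀ m → c m ≡ P ⊕ sgn m ⊗ Q) → (∀ m → c′ m ≡ U ⊖ sgn m ⊗ V) →
  (∀ k → g k ≡ U ⊗ A ^ k ⊖ V ⊗ B ^ k) → (∀ k → h k ≡ P ⊗ A′ ^ k ⊕ Q ⊗ B′ ^ k) →
  x ⊗ A ⊕ 𝟙 ≡ s ⊗ (x′ ⊗ A′ ⊕ 𝟙) → x ⊗ B ⊕ 𝟙 ≡ s ⊗ (x′ ⊗ A′ ⊖ 𝟙) →
  x ⊗ A ⊖ 𝟙 ≡ s ⊗ (x′ ⊗ B′ ⊕ 𝟙) → x ⊗ B ⊖ 𝟙 ≡ s ⊗ (x′ ⊗ B′ ⊖ 𝟙) →
  binomialSum n x c g ≡ s ^ n ⊗ binomialSum n x′ c′ h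
binomialSum-duality n x x′ s P Q U V A B A′ B′ {c} {c′} {g} {h} c≗ c′≗ g≗ h≗ e₁ e₂ e₃ e₄ = begin
  binomialSum n x c g
    ≡⟨ binomialSum-closedForm n x P Q U (neg V) A B c≗ g≗′ ⟩
  bilinearPowerSum U (neg V) P Q Y₁ Y₂ Y₃ Y₄ n
    ≡⟨ bilinearPowerSum-transpose U (neg V) P Q Y₁ Y₂ Y₃ Y₄ n ⟩
  bilinearPowerSum P Q U (neg V) Y₁ Y₃ Y₂ Y₄ n
    ≡⟨ cong₂ (λ a b → bilinearPowerSum P Q U (neg V) a b Y₂ Y₄ n) e₁ e₂ ⟩
  bilinearPowerSum P Q U (neg V) (s ⊗ Z₁) (s ⊗ Z₂) Y₂ Y₄ n
    ≡⟨ cong₂ (λ c d → bilinearPowerSum P Q U (neg V) (s ⊗ Z₁) (s ⊗ Z₂) c d n) e₃ e₄ ⟩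
  bilinearPowerSum P Q U (neg V) (s ⊗ Z₁) (s ⊗ Z₂) (s ⊗ Z₃) (s ⊗ Z₄) n
    ≡⟨ bilinearPowerSum-scale s P Q U (neg V) Z₁ Z₂ Z₃ Z₄ n ⟨
  s ^ n ⊗ bilinearPowerSum P Q U (neg V) Z₁ Z₂ Z₃ Z₄ n
    ≡⟨ cong (s ^ n ⊗_) (binomialSum-closedForm n x′ U (neg V) P Q A′ B′ c′≗′ h≗) ⟨
  s ^ n ⊗ binomialSum n x′ c′ h
    ∎
  where
  open ≡-Reasoning
  Y₁ Y₂ Y₃ Y₄ Z₁ Z₂ Z₃ Z₄ : ℚ√5
  Y₁ = x ⊗ A ⊕ 𝟙
  Y₂ = x ⊗ A ⊖ 𝟙
  Y₃ = x ⊗ B ⊕ 𝟙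
  Y₄ = x ⊗ B ⊖ 𝟙
  Z₁ = x′ ⊗ A′ ⊕ 𝟙
  Z₂ = x′ ⊗ A′ ⊖ 𝟙
  Z₃ = x′ ⊗ B′ ⊕ 𝟙
  Z₄ = x′ ⊗ B′ ⊖ 𝟙
  g≗′ : ∀ k → g k ≡ U ⊗ A ^ k ⊕ neg V ⊗ B ^ k
  g≗′ k = trans (g≗ k) (cong (U ⊗ A ^ k ⊕_) (-‿distribˡ-* V (B ^ k)))
  c′≗′ : ∀ m → c′ m ≡ U ⊕ sgn m ⊗ neg V
  c′≗′ m = trans (c′≗ m) (cong (U ⊕_) (-‿distribʳ-* (sgn m) V))

fibLucas-duality : ∀ n a b a′ p x x′ s {c c′ g h : ℕ → ℚ√5} →
  (∀ m → c m ≡ α ^ p ⊕ sgn m ⊗ β ^ p) → (∀ m → c′ m ≡ α ^ b ⊖ sgn m ⊗ β ^ b) →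
  (∀ k → g k ≡ F (a * k + b)) → (∀ k → h k ≡ L (a′ * k + p)) →
  x ⊗ α ^ a ⊕ 𝟙 ≡ s ⊗ (x′ ⊗ α ^ a′ ⊕ 𝟙) → x ⊗ β ^ a ⊕ 𝟙 ≡ s ⊗ (x′ ⊗ α ^ a′ ⊖ 𝟙) →
  x ⊗ α ^ a ⊖ 𝟙 ≡ s ⊗ (x′ ⊗ β ^ a′ ⊕ 𝟙) → x ⊗ β ^ a ⊖ 𝟙 ≡ s ⊗ (x′ ⊗ β ^ a′ ⊖ 𝟙) →
  √5 ⊗ binomialSum n x c g ≡ s ^ n ⊗ binomialSum n x′ c′ h
fibLucas-duality n a b a′ p x x′ s {c = c} {g = g} c≗ c′≗ g≗ h≗ e₁ e₂ e₃ e₄ =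
  trans (⊗-distribˡ-binomialSum n √5 x c g)
    (binomialSum-duality n x x′ s (α ^ p) (β ^ p) (α ^ b) (β ^ b) (α ^ a) (β ^ a) (α ^ a′) (β ^ a′) c≗ c′≗
      (λ k → trans (cong (√5 ⊗_) (g≗ k)) (binetF-progression a b k))
      (λ k → trans (h≗ k) (binetL-progression a′ p k))
      e₁ e₂ e₃ e₄)

fibLucas-selfDuality : ∀ n a b p x {c c′ g h : ℕ → ℚ√5} →
  (∀ m → c m ≡ α ^ p ⊕ sgn m ⊗ β ^ p) → (∀ m → c′ m ≡ α ^ b ⊖ sgn m ⊗ β ^ b) →
  (∀ k → g k ≡ F (a * k + b)) → (∀ k → h k ≡ L (a * k + p)) →
  x ⊗ α ^ a ⊖ 𝟙 ≡ x ⊗ β ^ a ⊕ 𝟙 →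
  √5 ⊗ binomialSum n x c g ≡ binomialSum n x c′ h
fibLucas-selfDuality n a b p x {c′ = c′} {h = h} c≗ c′≗ g≗ h≗ e =
  trans (fibLucas-duality n a b a p x x 𝟙 c≗ c′≗ g≗ h≗
           (unit (x ⊗ α ^ a ⊕ 𝟙)) (trans (sym e) (unit (x ⊗ α ^ a ⊖ 𝟙)))
           (trans e (unit (x ⊗ β ^ a ⊕ 𝟙))) (unit (x ⊗ β ^ a ⊖ 𝟙)))
        (trans (cong (_⊗ binomialSum n x c′ h) (^-zeroˡ n)) (⊗-identityˡ (binomialSum n x c′ h)))
  where
  unit : ∀ y → y ≡ 𝟙 ⊗ y
  unit y = sym (⊗-identityˡ y)

corollary13 : (n : ℕ) → 1 ≤ n →
      (√5 ⊗ Σ₁ n (λ k → binom n k ⊗ ((+ 2 / 1) /√5) ^ k ⊗ (𝟙 ⊕ sgn (n ∸ k)) ⊗ F (2 * k))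
        ≡ Σ₀ n (λ k → binom n k ⊗ ((+ 2 / 1) /√5) ^ k ⊗ (𝟙 ⊖ sgn (n ∸ k)) ⊗ L (2 * k)))
    × (√5 ⊗ Σ₀ n (λ k → binom n k ⊗ ((+ 2 / 3) /√5) ^ k ⊗ (α ^ 2 ⊕ sgn (n ∸ k) ⊗ β ^ 2) ⊗ F (4 * k + 2))
        ≡ Σ₀ n (λ k → binom n k ⊗ ((+ 2 / 3) /√5) ^ k ⊗ (α ^ 2 ⊖ sgn (n ∸ k) ⊗ β ^ 2) ⊗ L (4 * k + 2)))
    × (√5 ⊗ Σ₁ n (λ k → binom n k ⊗ ((+ 2 / 3) /√5) ^ k ⊗ (𝟙 ⊕ sgn (n ∸ k)) ⊗ F (4 * k))
        ≡ Σ₀ n (λ k → binom n k ⊗ ((+ 2 / 3) /√5) ^ k ⊗ (𝟙 ⊖ sgn (n ∸ k)) ⊗ L (4 * k)))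
    × (√5 ⊗ Σ₁ n (λ k → binom n k ⊗ ((+ 14 / 9) /√5) ^ k ⊗ (α ^ 2 ⊕ sgn (n ∸ k) ⊗ β ^ 2) ⊗ F (2 * k))
        ≡ ι (+ 7 / 9) ^ n ⊗ Σ₀ n (λ k → binom n k ⊗ ((+ 6 / 7) /√5) ^ k ⊗ (𝟙 ⊖ sgn (n ∸ k)) ⊗ L (4 * k + 2)))
    × (√5 ⊗ Σ₁ n (λ k → binom n k ⊗ ((+ 14 / 9) /√5) ^ k ⊗ (𝟙 ⊕ sgn (n ∸ k)) ⊗ F (2 * k))
        ≡ ι (+ 7 / 9) ^ n ⊗ Σ₀ n (λ k → binom n k ⊗ ((+ 6 / 7) /√5) ^ k ⊗ (𝟙 ⊖ sgn (n ∸ k)) ⊗ L (4 * k)))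
    × (√5 ⊗ Σ₀ n (λ k → binom n k ⊗ ((+ 6 / 7) /√5) ^ k ⊗ (𝟙 ⊕ sgn (n ∸ k)) ⊗ F (4 * k + 2))
        ≡ ι (+ 9 / 7) ^ n ⊗ Σ₀ n (λ k → binom n k ⊗ ((+ 14 / 9) /√5) ^ k ⊗ (α ^ 2 ⊖ sgn (n ∸ k) ⊗ β ^ 2) ⊗ L (2 * k)))
    × (√5 ⊗ Σ₀ n (λ k → binom n k ⊗ ((+ 2 / 3) /√5) ^ k ⊗ (𝟙 ⊕ sgn (n ∸ k)) ⊗ F (4 * k + 2))
        ≡ Σ₀ n (λ k → binom n k ⊗ ((+ 2 / 3) /√5) ^ k ⊗ (α ^ 2 ⊖ sgn (n ∸ k) ⊗ β ^ 2) ⊗ L (4 * k)))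
    × (√5 ⊗ Σ₁ n (λ k → binom n k ⊗ ((+ 6 / 7) /√5) ^ k ⊗ (𝟙 ⊕ sgn (n ∸ k)) ⊗ F (4 * k))
        ≡ ι (+ 9 / 7) ^ n ⊗ Σ₀ n (λ k → binom n k ⊗ ((+ 14 / 9) /√5) ^ k ⊗ (𝟙 ⊖ sgn (n ∸ k)) ⊗ L (2 * k)))
    × (√5 ⊗ Σ₁ n (λ k → binom n k ⊗ ((+ 2 / 3) /√5) ^ k ⊗ (α ^ 2 ⊕ sgn (n ∸ k) ⊗ β ^ 2) ⊗ F (4 * k))
        ≡ Σ₀ n (λ k → binom n k ⊗ ((+ 2 / 3) /√5) ^ k ⊗ (𝟙 ⊖ sgn (n ∸ k)) ⊗ L (4 * k + 2)))
corollary13 n _ =  -- the identities hold for n = 0 as well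
    dropZero plain refl (fibLucas-selfDuality n 2 0 0 x₁ plain≡ plain≡′ (multiple F 2) (multiple L 2) refl)
  , fibLucas-selfDuality n 4 2 2 x₂ (λ _ → refl) (λ _ → refl) (λ _ → refl) (λ _ → refl) refl
  , dropZero plain refl (fibLucas-selfDuality n 4 0 0 x₂ plain≡ plain≡′ (multiple F 4) (multiple L 4) refl)
  , dropZero golden refl (fibLucas-duality n 2 0 4 2 x₃ x₄ (ι (+ 7 / 9)) (λ _ → refl) plain≡′ (multiple F 2) (λ _ → refl)
                                            refl refl refl refl)
  , dropZero plain refl (fibLucas-duality n 2 0 4 0 x₃ x₄ (ι (+ 7 / 9)) plain≡ plain≡′ (multiple F 2) (multiple L 4)
                                           refl refl refl refl)
  , fibLucas-duality n 4 2 2 0 x₄ x₃ (ι (+ 9 / 7)) plain≡ (λ _ → refl) (λ _ → refl) (multiple L 2) refl refl refl refl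
  , fibLucas-selfDuality n 4 2 0 x₂ plain≡ (λ _ → refl) (λ _ → refl) (multiple L 4) refl
  , dropZero plain refl (fibLucas-duality n 4 0 2 0 x₄ x₃ (ι (+ 9 / 7)) plain≡ plain≡′ (multiple F 4) (multiple L 2)
                                           refl refl refl refl)
  , dropZero golden refl (fibLucas-selfDuality n 4 0 2 x₂ (λ _ → refl) plain≡′ (multiple F 4) (λ _ → refl) refl)
  where
  x₁ x₂ x₃ x₄ : ℚ√5
  x₁ = (+ 2 / 1) /√5
  x₂ = (+ 2 / 3) /√5
  x₃ = (+ 14 / 9) /√5
  x₄ = (+ 6 / 7) /√5
  plain golden : ℕ → ℚ√5
  plain m = 𝟙 ⊕ sgn m
  golden m = α ^ 2 ⊕ sgn m ⊗ β ^ 2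
  plain≡ : ∀ m → plain m ≡ α ^ 0 ⊕ sgn m ⊗ β ^ 0
  plain≡ m = cong (𝟙 ⊕_) (sym (⊗-identityʳ (sgn m)))
  plain≡′ : ∀ m → 𝟙 ⊖ sgn m ≡ α ^ 0 ⊖ sgn m ⊗ β ^ 0
  plain≡′ m = cong (𝟙 ⊖_) (sym (⊗-identityʳ (sgn m)))
  multiple : ∀ (u : ℕ → ℚ√5) a k → u (a * k) ≡ u (a * k + 0)
  multiple u a k = cong u (sym (ℕP.+-identityʳ (a * k)))
  dropZero : ∀ c {x g y} → g 0 ≡ 𝟘 → √5 ⊗ binomialSum n x c g ≡ y →
             √5 ⊗ Σ₁ n (λ k → binom n k ⊗ x ^ k ⊗ c (n ∸ k) ⊗ g k) ≡ y
  dropZero c {x} {g} g0≡0 = trans (cong (√5 ⊗_) (Σ₁-binomialSum n x c g g0≡0))
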